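{- Let $G$ be a finite graph. Suppose that for all entanglements $\varepsilon_1,\varepsilon_2$ in $G$ (possibly $\varepsilon_1=\varepsilon_2$) and any two crossing separations $s_1\in\varepsilon_1$ and $s_2\in\varepsilon_2$, at least one of the following holds: (C1) there are opposite corners $c_1,c_2$ of $s_1,s_2$ with $c_1\in\varepsilon_1$ and $c_2\in\varepsilon_2$; (C2) two opposite corners of $s_1,s_2$ are in $\varepsilon_1$, and the other two opposite corners of $s_1,s_2$ are in $\varepsilon_2$. Then the set of friendly separations of $G$ is nested.
   Context: A separation of a graph $G$ is a set $\{A,B\}$ with $A\cup B=V(G)$ such that $G$ has no edge between $A\setminus B$ and $B\setminus A$; its order is $|A\cap B|$; it is proper if $A\setminus B,B\setminus A\neq\emptyset$. Two separations $\{A,B\},\{C,D\}$ are nested if, after possibly renaming sides, $A\subseteq C$ and $B\supseteq D$; otherwise they cross. A set of separations is nested if its elements are pairwise nested. For crossing $\{A,B\},\{C,D\}$ the four corners are $\{A\cap C,B\cup D\}$, $\{A\cap D,B\cup C\}$, $\{B\cap D,A\cup C\}$, $\{B\cap C,A\cup D\}$; $\{A\cap C,B\cup D\}$ and $\{B\cap D,A\cup C\}$ are opposite, as are $\{A\cap D,B\cup C\}$ and $\{B\cap C,A\cup D\}$. The first two corners lie on the same side of $\{A,B\}$, as do the last two. An entanglement in $G$ is a non-empty set $\varepsilon$ of proper separations such that: if $\{A,B\}\in\varepsilon$ is crossed by a separation of $G$ so that two corners lying on the same side of $\{A,B\}$ have order at most $|A\cap B|$, then at least one of them has order equal to $|A\cap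 B|$ and lies in $\varepsilon$. For a separation $s$, $x(s)$ is the number of separations lying in (at least one) entanglement in $G$ that are crossed by $s$. A separation $s$ is friendly if it lies in some entanglement $\varepsilon$ such that no other separation in $\varepsilon$ has smaller value of $x$ than $s$. -}

module Defs where

open import Data.Nat using (ℕ; _≤_; _<_)
open import Data.Fin using (Fin)
open import Data.Fin.Subset using (Subset; _∩_; _∪_; _─_; _⊆_; _∈_; ∣_∣; ⊤; Nonempty)
open import Data.Product using (Σ; ∃; _×_; _,_; proj₁; proj₂)
open import Data.Sum using (_⊎_)
open import Data.List using (List; length)
open import Data.List.Relation.Unary.All using (All)
open import Data.List.Relation.Unary.Any using (Any)
open import Data.List.Relation.Unary.AllPairs using (AllPairs)
open import Relation.Nullary using (¬_)
open import Relation.Binary.PropositionalEquality using (_≡_)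
open import Data.Empty using (⊥)

record Graph : Set₁ where
  field
    n      : ℕ
    Adj    : Fin n → Fin n → Set
    sym    : ∀ {u v} → Adj u v → Adj v u
    irrefl : ∀ {u} → ¬ Adj u u

open Graph public

-- An (oriented) pair of vertex sets (A , B).  The unordered separation
-- {A,B} is represented by either orientation; see _≈_.
Sep : ℕ → Set
Sep n = Subset n × Subset n

swap : ∀ {n} → Sep n → Sep n
swap (A , B) = (B , A)

_≈_ : ∀ {n} → Sep n → Sep n → Set
s ≈ t = (s ≡ t) ⊎ (s ≡ swap t)

IsSeparation : (G : Graph) → Sep (n G) → Set
IsSeparation G (A , B) =
  (A ∪ B ≡ ⊤) ×
  (∀ u v → u ∈ (A ─ B) → v ∈ (B ─ A) → ¬ Adj G u v)

order : ∀ {n} → Sep n → ℕ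
order (A , B) = ∣ A ∩ B ∣

IsProper : ∀ {n} → Sep n → Set
IsProper (A , B) = Nonempty (A ─ B) × Nonempty (B ─ A)

Nested : ∀ {n} → Sep n → Sep n → Set
Nested (A , B) (C , D) =
  ((A ⊆ C) × (D ⊆ B)) ⊎ ((A ⊆ D) × (C ⊆ B)) ⊎
  ((B ⊆ C) × (D ⊆ A)) ⊎ ((B ⊆ D) × (C ⊆ A))

Cross : ∀ {n} → Sep n → Sep n → Set
Cross s t = ¬ Nested s t

corner₁ corner₂ corner₃ corner₄ : ∀ {n} → Sep n → Sep n → Sep n
corner₁ (A , B) (C , D) = (A ∩ C , B ∪ D)
corner₂ (A , B) (C , D) = (A ∩ D , B ∪ C)
corner₃ (A , B) (C , D) = (B ∩ D , A ∪ C)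
corner₄ (A , B) (C , D) = (B ∩ C , A ∪ D)
-- corner₁/corner₃ are opposite, corner₂/corner₄ are opposite;
-- corner₁, corner₂ lie on the A-side of (A,B); corner₃, corner₄ on the B-side.

-- A set of (unordered) separations, represented as a predicate on oriented
-- pairs that is closed under swapping the sides.
SepSet : ℕ → Set₁
SepSet n = Sep n → Set

SwapClosed : ∀ {n} → SepSet n → Set
SwapClosed ε = ∀ s → ε s → ε (swap s)

-- Entanglement.  Since ε is swap-closed and (C,D) ranges over both
-- orientations, considering the A-side corners of every oriented (A,B) ∈ ε
-- covers both sides of every unordered {A,B} ∈ ε.
IsEntanglement : (G : Graph) → SepSet (n G) → Set
IsEntanglement G ε =
  SwapClosed ε ×
  (∃ λ s → ε s) ×
  (∀ s → ε s → IsSeparation G s × IsProper s) ×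
  (∀ s t → ε s → IsSeparation G t → Cross s t →
     order (corner₁ s t) ≤ order s → order (corner₂ s t) ≤ order s →
       ((order (corner₁ s t) ≡ order s) × ε (corner₁ s t)) ⊎
       ((order (corner₂ s t) ≡ order s) × ε (corner₂ s t)))

InSomeEntanglement : (G : Graph) → Sep (n G) → Set₁
InSomeEntanglement G t = Σ (SepSet (n G)) λ ε → IsEntanglement G ε × ε t

-- CountIs P k : the set of unordered separations satisfying P (P assumed
-- invariant under swapping sides) has exactly k elements: a list without
-- repetitions (up to _≈_) enumerating it.
CountIs : ∀ {n} → (Sep n → Set₁) → ℕ → Set₁
CountIs {n} P k = Σ (List (Sep n)) λ L →
  AllPairs (λ a b → ¬ (a ≈ b)) L × All P L ×
  (∀ t → P t → Any (t ≈_) L) × (length L ≡ k)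

XIs : (G : Graph) → Sep (n G) → ℕ → Set₁
XIs G s k = CountIs (λ t → InSomeEntanglement G t × Cross s t) k

Friendly : (G : Graph) → Sep (n G) → Set₁
Friendly G s = Σ (SepSet (n G)) λ ε → IsEntanglement G ε × ε s ×
  Σ ℕ λ k → XIs G s k ×
    (∀ t k′ → ε t → XIs G t k′ → ¬ (k′ < k))

C1 : ∀ {n} → SepSet n → SepSet n → Sep n → Sep n → Set
C1 ε₁ ε₂ s₁ s₂ =
  (ε₁ (corner₁ s₁ s₂) × ε₂ (corner₃ s₁ s₂)) ⊎
  (ε₁ (corner₃ s₁ s₂) × ε₂ (corner₁ s₁ s₂)) ⊎
  (ε₁ (corner₂ s₁ s₂) × ε₂ (corner₄ s₁ s₂)) ⊎
  (ε₁ (corner₄ s₁ s₂) × ε₂ (corner₂ s₁ s₂))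

C2 : ∀ {n} → SepSet n → SepSet n → Sep n → Sep n → Set
C2 ε₁ ε₂ s₁ s₂ =
  (ε₁ (corner₁ s₁ s₂) × ε₁ (corner₃ s₁ s₂) ×
   ε₂ (corner₂ s₁ s₂) × ε₂ (corner₄ s₁ s₂)) ⊎
  (ε₁ (corner₂ s₁ s₂) × ε₁ (corner₄ s₁ s₂) ×
   ε₂ (corner₁ s₁ s₂) × ε₂ (corner₃ s₁ s₂))

-- Suppose friendly s ∈ εs and t ∈ εt cross.  A separation crossing a corner
-- of s and t crosses s or t, and one crossing two opposite corners crosses
-- both; moreover s itself is counted in x(t) but crosses neither corner,
-- being nested with all four.  Counting over the entangled separations that
-- cross s or t therefore gives x(c) + x(c′) < x(s) + x(t) for each pair c, c′
-- of opposite corners.  Under (C1), friendliness gives x(s) ≤ x(c) and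
-- x(t) ≤ x(c′) for one such pair; under (C2) it gives x(s) + x(s) < x(s) + x(t)
-- and x(t) + x(t) < x(s) + x(t).

module Submission where

open import Defs
open import Algebra.Properties.CommutativeSemigroup using (interchange)
open import Data.Bool.Properties using () renaming (_≟_ to _≟ᴮ_)
open import Data.Empty using (⊥; ⊥-elim)
open import Data.Fin.Subset using (_⊆_)
open import Data.Fin.Subset.Properties
  using (_⊆?_; ⊆-trans; p∩q⊆p; p∩q⊆q; x∈p∩q⁺; p⊆p∪q; q⊆p∪q; x∈p∪q⁻)
open import Data.List using (List; []; _∷_; _++_; length; filter; deduplicate)
open import Data.List.Properties using (length-removeAt′)
open import Data.List.Relation.Unary.All as All using (All; []; _∷_)
import Data.List.Relation.Unary.All.Properties as All
open import Data.List.Relation.Unary.Any as Any using (Any; here; there; _─_)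
open import Data.List.Relation.Unary.AllPairs using ([]; _∷_)
import Data.List.Membership.Setoid as Membership
import Data.List.Membership.Setoid.Properties as MembershipP
import Data.List.Relation.Unary.Unique.Setoid as Unique
import Data.List.Relation.Unary.Unique.DecSetoid.Properties as UniqueD
import Data.List.Relation.Unary.Unique.Setoid.Properties as UniqueP
open import Data.Nat using (ℕ; suc; _+_; _≤_; _<_; z≤n; s≤s)
open import Data.Nat.Properties
  using (+-mono-≤; +-mono-≤-<; +-mono-<-≤; ≤-<-trans; ≮⇒≥; <-irrefl; <-asym;
         +-comm; +-cancelˡ-<; +-cancelʳ-<; +-commutativeSemigroup; module ≤-Reasoning)
open import Data.Product using (_×_; _,_; proj₁; proj₂; ∃₂)
import Data.Product as Product
open import Data.Product.Properties using () renaming (≡-dec to ×-≡-dec)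
open import Data.Sum using (_⊎_; inj₁; inj₂; [_,_]′)
import Data.Sum as Sum
open import Data.Vec.Properties using () renaming (≡-dec to Vec-≡-dec)
open import Function using (_∘_)
open import Level using (0ℓ)
open import Relation.Binary using (Setoid; DecSetoid; Decidable; DecidableEquality; _Respects_)
open import Relation.Binary.PropositionalEquality
  using (_≡_; refl; cong; subst; subst₂) renaming (sym to sym′)
open import Relation.Nullary using (¬_; Dec; yes; no; contradiction)
open import Relation.Nullary.Decidable using (_×-dec_; _⊎-dec_; ¬?)
open import Relation.Unary using (Pred) renaming (Decidable to Decidable₁)

private
  variable
    m : ℕ
    r s t u c c′ : Sep m

module _ {a ℓ} (S : Setoid a ℓ) where
  open Setoid S using () renaming (_≈_ to _≃_; sym to ≃-sym; trans to ≃-trans)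
  open Membership S using (_∈_)
  open Unique S using (Unique)

  ∈-─ : ∀ {x y ys} (x∈ys : x ∈ ys) → ¬ x ≃ y → y ∈ ys → y ∈ (ys ─ x∈ys)
  ∈-─ (here x≈z)   x≉y (here y≈z)   = contradiction (≃-trans x≈z (≃-sym y≈z)) x≉y
  ∈-─ (here _)     _   (there y∈ys) = y∈ys
  ∈-─ (there _)    _   (here y≈z)   = here y≈z
  ∈-─ (there x∈ys) x≉y (there y∈ys) = there (∈-─ x∈ys x≉y y∈ys)

  Unique-length-≤ : ∀ {xs ys} → Unique xs → All (_∈ ys) xs → length xs ≤ length ys
  Unique-length-≤ []            []               = z≤n
  Unique-length-≤ {ys = ys} (x≉xs ∷ xs!) (x∈ys ∷ xs⊆ys) =
    subst (suc _ ≤_) (sym′ (length-removeAt′ ys _))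
      (s≤s (Unique-length-≤ xs! (All.zipWith (λ (x≉y , y∈ys) → ∈-─ x∈ys x≉y y∈ys)
                                             (x≉xs , xs⊆ys))))

indicator : {P : Set} → Dec P → ℕ
indicator (yes _) = 1
indicator (no _)  = 0

module _ {P P′ Q R : Set} where

  0<indicator-+ : (q? : Dec Q) (r? : Dec R) → Q ⊎ R → 0 < indicator q? + indicator r?
  0<indicator-+ (yes _) _       _   = s≤s z≤n
  0<indicator-+ (no _)  (yes _) _   = s≤s z≤n
  0<indicator-+ (no ¬q) (no ¬r) q⊎r = contradiction q⊎r [ ¬q , ¬r ]′

  indicator-+-≤ : (P → Q ⊎ R) → (P′ → Q ⊎ R) → (P → P′ → Q × R) →
    (p? : Dec P) (p′? : Dec P′) (q? : Dec Q) (r? : Dec R) →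
    indicator p? + indicator p′? ≤ indicator q? + indicator r?
  indicator-+-≤ _ _ _ (no _) (no _) _ _ = z≤n
  indicator-+-≤ P⇒Q∪R _ _ (yes p) (no _) q? r? = 0<indicator-+ q? r? (P⇒Q∪R p)
  indicator-+-≤ _ P′⇒Q∪R _ (no _) (yes p′) q? r? = 0<indicator-+ q? r? (P′⇒Q∪R p′)
  indicator-+-≤ _ _ _ (yes _) (yes _) (yes _) (yes _) = s≤s (s≤s z≤n)
  indicator-+-≤ _ _ P∩P′⇒Q∩R (yes p) (yes p′) (no ¬q) _ = contradiction (proj₁ (P∩P′⇒Q∩R p p′)) ¬q
  indicator-+-≤ _ _ P∩P′⇒Q∩R (yes p) (yes p′) _ (no ¬r) = contradiction (proj₂ (P∩P′⇒Q∩R p p′)) ¬r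

  indicator-+-< : ¬ P → ¬ P′ → Q ⊎ R →
    (p? : Dec P) (p′? : Dec P′) (q? : Dec Q) (r? : Dec R) →
    indicator p? + indicator p′? < indicator q? + indicator r?
  indicator-+-< ¬p _   _   (yes p) _        _  _  = contradiction p ¬p
  indicator-+-< _  ¬p′ _   (no _)  (yes p′) _  _  = contradiction p′ ¬p′
  indicator-+-< _  _   q⊎r (no _)  (no _)   q? r? = 0<indicator-+ q? r? q⊎r

module _ {A : Set} where

  count : {P : Pred A 0ℓ} → Decidable₁ P → List A → ℕ
  count P? []       = 0
  count P? (x ∷ xs) = indicator (P? x) + count P? xs

  length-filter≡count : {P : Pred A 0ℓ} (P? : Decidable₁ P) (xs : List A) →
                        length (filter P? xs) ≡ count P? xs
  length-filter≡count P? [] = refl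
  length-filter≡count P? (x ∷ xs) with P? x
  ... | yes _ = cong suc (length-filter≡count P? xs)
  ... | no _  = length-filter≡count P? xs

  module _ {P P′ Q R : Pred A 0ℓ}
           (P? : Decidable₁ P) (P′? : Decidable₁ P′) (Q? : Decidable₁ Q) (R? : Decidable₁ R)
           (P⇒Q∪R : ∀ {x} → P x → Q x ⊎ R x) (P′⇒Q∪R : ∀ {x} → P′ x → Q x ⊎ R x)
           (P∩P′⇒Q∩R : ∀ {x} → P x → P′ x → Q x × R x) where

    private
      count-∷-mono : (_∼₁_ _∼₂_ _∼_ : ℕ → ℕ → Set) →
        (∀ {w x y z} → w ∼₁ x → y ∼₂ z → (w + y) ∼ (x + z)) → ∀ x xs →
        (indicator (P? x) + indicator (P′? x)) ∼₁ (indicator (Q? x) + indicator (R? x)) →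
        (count P? xs + count P′? xs) ∼₂ (count Q? xs + count R? xs) →
        (count P? (x ∷ xs) + count P′? (x ∷ xs)) ∼ (count Q? (x ∷ xs) + count R? (x ∷ xs))
      count-∷-mono _ _ _∼_ mono x xs head tail = subst₂ _∼_
        (interchange +-commutativeSemigroup
          (indicator (P? x)) (indicator (P′? x)) (count P? xs) (count P′? xs))
        (interchange +-commutativeSemigroup
          (indicator (Q? x)) (indicator (R? x)) (count Q? xs) (count R? xs))
        (mono head tail)

    count-+-≤ : ∀ xs → count P? xs + count P′? xs ≤ count Q? xs + count R? xs
    count-+-≤ []       = z≤n
    count-+-≤ (x ∷ xs) = count-∷-mono _≤_ _≤_ _≤_ +-mono-≤ x xs
      (indicator-+-≤ P⇒Q∪R P′⇒Q∪R P∩P′⇒Q∩R (P? x) (P′? x) (Q? x) (R? x)) (count-+-≤ xs)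

    count-+-< : ∀ {xs} → Any (λ x → ¬ P x × ¬ P′ x × (Q x ⊎ R x)) xs →
                count P? xs + count P′? xs < count Q? xs + count R? xs
    count-+-< {x ∷ xs} (here (¬p , ¬p′ , q⊎r)) = count-∷-mono _<_ _≤_ _<_ +-mono-<-≤ x xs
      (indicator-+-< ¬p ¬p′ q⊎r (P? x) (P′? x) (Q? x) (R? x)) (count-+-≤ xs)
    count-+-< {x ∷ xs} (there any) = count-∷-mono _≤_ _<_ _<_ +-mono-≤-< x xs
      (indicator-+-≤ P⇒Q∪R P′⇒Q∪R P∩P′⇒Q∩R (P? x) (P′? x) (Q? x) (R? x)) (count-+-< any)

infix 4 _≼_

_≼_ : Sep m → Sep m → Set
(A , B) ≼ (C , D) = (A ⊆ C) × (D ⊆ B)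

≼-trans : r ≼ s → s ≼ t → r ≼ t
≼-trans (A⊆C , D⊆B) (C⊆E , F⊆D) = ⊆-trans A⊆C C⊆E , ⊆-trans F⊆D D⊆B

≼-swap : s ≼ t → swap t ≼ swap s
≼-swap (A⊆C , D⊆B) = D⊆B , A⊆C

-- Unfolding the definitions, Nested s t is literally the disjunction
--   s ≼ t ⊎ s ≼ swap t ⊎ swap s ≼ t ⊎ swap s ≼ swap t,
-- and swap (swap s) reduces to s; both facts are used silently below.

≼⇒Nested : s ≼ t → Nested s t
≼⇒Nested = inj₁

Nested-sym : Nested s t → Nested t s
Nested-sym (inj₁ s≼t)               = inj₂ (inj₂ (inj₂ (≼-swap s≼t)))
Nested-sym (inj₂ (inj₁ s≼t̄))        = inj₂ (inj₁ (≼-swap s≼t̄))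
Nested-sym (inj₂ (inj₂ (inj₁ s̄≼t))) = inj₂ (inj₂ (inj₁ (≼-swap s̄≼t)))
Nested-sym (inj₂ (inj₂ (inj₂ s̄≼t̄))) = inj₁ (≼-swap s̄≼t̄)

Nested-swapʳ : Nested s t → Nested s (swap t)
Nested-swapʳ (inj₁ s≼t)               = inj₂ (inj₁ s≼t)
Nested-swapʳ (inj₂ (inj₁ s≼t̄))        = inj₁ s≼t̄
Nested-swapʳ (inj₂ (inj₂ (inj₁ s̄≼t))) = inj₂ (inj₂ (inj₂ s̄≼t))
Nested-swapʳ (inj₂ (inj₂ (inj₂ s̄≼t̄))) = inj₂ (inj₂ (inj₁ s̄≼t̄))

Nested-swapˡ : Nested s t → Nested (swap s) t
Nested-swapˡ = Nested-sym ∘ Nested-swapʳ ∘ Nested-sym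

Cross-swapʳ : Cross s t → Cross s (swap t)
Cross-swapʳ s⋈t = s⋈t ∘ Nested-swapʳ

Cross-swapˡ : Cross s t → Cross (swap s) t
Cross-swapˡ s⋈t = s⋈t ∘ Nested-swapˡ

Nested? : (s t : Sep m) → Dec (Nested s t)
Nested? (A , B) (C , D) =
  ((A ⊆? C) ×-dec (D ⊆? B)) ⊎-dec ((A ⊆? D) ×-dec (C ⊆? B)) ⊎-dec
  ((B ⊆? C) ×-dec (D ⊆? A)) ⊎-dec ((B ⊆? D) ×-dec (C ⊆? A))

Cross? : (s t : Sep m) → Dec (Cross s t)
Cross? s t = ¬? (Nested? s t)

-- corner₁ is the infimum for ≼; the other corners are corner₁ of
-- reoriented separations: corner₂ s t, corner₃ s t and corner₄ s t reduce to
-- corner₁ s (swap t), corner₁ (swap s) (swap t) and corner₁ (swap s) t.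

corner₁-≼ˡ : (s t : Sep m) → corner₁ s t ≼ s
corner₁-≼ˡ (A , B) (C , D) = p∩q⊆p A C , p⊆p∪q D

corner₁-≼ʳ : (s t : Sep m) → corner₁ s t ≼ t
corner₁-≼ʳ (A , B) (C , D) = p∩q⊆q A C , q⊆p∪q B D

corner₁-greatest : r ≼ s → r ≼ t → r ≼ corner₁ s t
corner₁-greatest {s = A , B} {t = C , D} (E⊆A , B⊆F) (E⊆C , D⊆F) =
  (λ x∈E → x∈p∩q⁺ (E⊆A x∈E , E⊆C x∈E)) ,
  (λ x∈B∪D → [ B⊆F , D⊆F ]′ (x∈p∪q⁻ B D x∈B∪D))

Nested-corner₁ : Cross s t → Nested r s → Nested r t → Nested r (corner₁ s t)
Nested-corner₁ {s = s} {t} _ (inj₂ (inj₁ r≼s̄)) _ =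
  inj₂ (inj₁ (≼-trans r≼s̄ (≼-swap (corner₁-≼ˡ s t))))
Nested-corner₁ {s = s} {t} _ (inj₂ (inj₂ (inj₂ r̄≼s̄))) _ =
  inj₂ (inj₂ (inj₂ (≼-trans r̄≼s̄ (≼-swap (corner₁-≼ˡ s t)))))
Nested-corner₁ {s = s} {t} _ _ (inj₂ (inj₁ r≼t̄)) =
  inj₂ (inj₁ (≼-trans r≼t̄ (≼-swap (corner₁-≼ʳ s t))))
Nested-corner₁ {s = s} {t} _ _ (inj₂ (inj₂ (inj₂ r̄≼t̄))) =
  inj₂ (inj₂ (inj₂ (≼-trans r̄≼t̄ (≼-swap (corner₁-≼ʳ s t)))))
Nested-corner₁ _ (inj₁ r≼s) (inj₁ r≼t) = inj₁ (corner₁-greatest r≼s r≼t)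
Nested-corner₁ _ (inj₂ (inj₂ (inj₁ r̄≼s))) (inj₂ (inj₂ (inj₁ r̄≼t))) =
  inj₂ (inj₂ (inj₁ (corner₁-greatest r̄≼s r̄≼t)))
Nested-corner₁ s⋈t (inj₁ r≼s) (inj₂ (inj₂ (inj₁ r̄≼t))) =
  contradiction (inj₂ (inj₂ (inj₁ (≼-trans (≼-swap r≼s) r̄≼t)))) s⋈t
Nested-corner₁ s⋈t (inj₂ (inj₂ (inj₁ r̄≼s))) (inj₁ r≼t) =
  contradiction (inj₂ (inj₂ (inj₁ (≼-trans (≼-swap r̄≼s) r≼t)))) s⋈t

Nested-opposite : c ≼ u → c′ ≼ swap u → Nested r u → Nested r c ⊎ Nested r c′
Nested-opposite c≼u c′≼ū (inj₁ r≼u) =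
  inj₂ (inj₂ (inj₁ (≼-trans r≼u (≼-swap c′≼ū))))
Nested-opposite c≼u c′≼ū (inj₂ (inj₁ r≼ū)) =
  inj₁ (inj₂ (inj₁ (≼-trans r≼ū (≼-swap c≼u))))
Nested-opposite c≼u c′≼ū (inj₂ (inj₂ (inj₁ r̄≼u))) =
  inj₂ (inj₂ (inj₂ (inj₂ (≼-trans r̄≼u (≼-swap c′≼ū)))))
Nested-opposite c≼u c′≼ū (inj₂ (inj₂ (inj₂ r̄≼ū))) =
  inj₁ (inj₂ (inj₂ (inj₂ (≼-trans r̄≼ū (≼-swap c≼u)))))

corner₁-Cross : Cross s t → Cross (corner₁ s t) r → Cross s r ⊎ Cross t r
corner₁-Cross {s = s} {t} {r} s⋈t c⋈r with Nested? s r | Nested? t r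
... | no s⋈r  | _        = inj₁ s⋈r
... | yes _   | no t⋈r   = inj₂ t⋈r
... | yes s∥r | yes t∥r  =
  contradiction (Nested-sym (Nested-corner₁ s⋈t (Nested-sym s∥r) (Nested-sym t∥r))) c⋈r

corner₃-Cross : Cross s t → Cross (corner₃ s t) r → Cross s r ⊎ Cross t r
corner₃-Cross s⋈t =
  Sum.map Cross-swapˡ Cross-swapˡ ∘ corner₁-Cross (Cross-swapˡ (Cross-swapʳ s⋈t))

opposite-corners-Cross : Cross (corner₁ s t) r → Cross (corner₃ s t) r →
                         Cross s r × Cross t r
opposite-corners-Cross {s = s} {t} {r} c⋈r c′⋈r =
  (λ s∥r → excluded (Nested-opposite (corner₁-≼ˡ s t) (corner₁-≼ˡ (swap s) (swap t))
                                     (Nested-sym s∥r))) ,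
  (λ t∥r → excluded (Nested-opposite (corner₁-≼ʳ s t) (corner₁-≼ʳ (swap s) (swap t))
                                     (Nested-sym t∥r)))
  where
  excluded : Nested r (corner₁ s t) ⊎ Nested r (corner₃ s t) → ⊥
  excluded = [ c⋈r ∘ Nested-sym , c′⋈r ∘ Nested-sym ]′

≈-sym : s ≈ t → t ≈ s
≈-sym (inj₁ refl) = inj₁ refl
≈-sym (inj₂ refl) = inj₂ refl

≈-trans : r ≈ s → s ≈ t → r ≈ t
≈-trans (inj₁ refl) s≈t         = s≈t
≈-trans (inj₂ refl) (inj₁ refl) = inj₂ refl
≈-trans (inj₂ refl) (inj₂ refl) = inj₁ refl

_≟_ : DecidableEquality (Sep m)
_≟_ = ×-≡-dec (Vec-≡-dec _≟ᴮ_) (Vec-≡-dec _≟ᴮ_)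

_≈?_ : Decidable (_≈_ {m})
s ≈? t = (s ≟ t) ⊎-dec (s ≟ swap t)

≈-decSetoid : ℕ → DecSetoid 0ℓ 0ℓ
≈-decSetoid m = record
  { Carrier = Sep m
  ; _≈_ = _≈_
  ; isDecEquivalence = record
    { isEquivalence = record { refl = inj₁ refl ; sym = ≈-sym ; trans = ≈-trans }
    ; _≟_ = _≈?_
    }
  }

Nested-resp-≈ : (s : Sep m) → Nested s Respects _≈_
Nested-resp-≈ s (inj₁ refl) s∥t = s∥t
Nested-resp-≈ s (inj₂ refl) s∥t = Nested-swapʳ s∥t

Cross-resp-≈ : (s : Sep m) → Cross s Respects _≈_
Cross-resp-≈ s t≈u s⋈t = s⋈t ∘ Nested-resp-≈ s (≈-sym t≈u)

CountIs-≤ : ∀ {P : Sep m → Set₁} {k k′} → CountIs P k → CountIs P k′ → k ≤ k′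
CountIs-≤ {m} (L , L! , all-P , _ , refl) (_ , _ , _ , complete′ , refl) =
  Unique-length-≤ (DecSetoid.setoid (≈-decSetoid m)) L! (All.map (λ {t} → complete′ t) all-P)

XIs-swap : ∀ {G k} {t : Sep (n G)} → XIs G t k → XIs G (swap t) k
XIs-swap (L , L! , all-L , complete , len) =
  L , L! , All.map (Product.map₂ Cross-swapˡ) all-L ,
  (λ u (ent-u , t̄⋈u) → complete u (ent-u , Cross-swapˡ t̄⋈u)) , len

module _ (G : Graph) where
  open DecSetoid (≈-decSetoid (n G)) using (setoid)
  open Membership setoid using (_∈_)
  open Unique setoid using (Unique)

  private
    Entangled : Sep (n G) → Set₁
    Entangled = InSomeEntanglement G

  XIs-filter : ∀ {c} W → Unique W → All Entangled W →
               (∀ u → Entangled u → Cross c u → u ∈ W) → XIs G c (count (Cross? c) W)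
  XIs-filter {c} W W! ent-W complete =
    filter (Cross? c) W ,
    UniqueP.filter⁺ setoid (Cross? c) W! ,
    All.zip (All.filter⁺ (Cross? c) ent-W , All.all-filter (Cross? c) W) ,
    (λ u (ent-u , c⋈u) →
      MembershipP.∈-filter⁺ setoid (Cross? c) (Cross-resp-≈ c) (complete u ent-u c⋈u) c⋈u) ,
    length-filter≡count (Cross? c) W

  opposite-corners-x : ∀ {s t : Sep (n G)} {ks kt} → Entangled s → Cross s t →
    XIs G s ks → XIs G t kt →
    ∃₂ λ k k′ → XIs G (corner₁ s t) k × XIs G (corner₃ s t) k′ × k + k′ < ks + kt
  opposite-corners-x {s} {t} {ks} {kt} ent-s s⋈t
                     Xs@(Ls , _ , all-Ls , complete-Ls , _)
                     Xt@(Lt , _ , all-Lt , complete-Lt , _) =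
    _ , _ , X₁ , X₃ ,
    (begin-strict
      count (Cross? c₁) W + count (Cross? c₃) W
        <⟨ count-+-< (Cross? c₁) (Cross? c₃) (Cross? s) (Cross? t)
                     (corner₁-Cross s⋈t) (corner₃-Cross s⋈t) opposite-corners-Cross
                     s-strict ⟩
      count (Cross? s) W + count (Cross? t) W
        ≤⟨ +-mono-≤ (CountIs-≤ (counted-in-W (λ _ _ → inj₁)) Xs)
                    (CountIs-≤ (counted-in-W (λ _ _ → inj₂)) Xt) ⟩
      ks + kt ∎)
    where
    open ≤-Reasoning
    c₁ c₃ : Sep (n G)
    c₁ = corner₁ s t
    c₃ = corner₃ s t

    W : List (Sep (n G))
    W = deduplicate _≈?_ (Ls ++ Lt)

    ∈-W : ∀ {u} → Entangled u → Cross s u ⊎ Cross t u → u ∈ W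
    ∈-W {u} ent-u s⋈u⊎t⋈u = MembershipP.∈-deduplicate⁺ setoid _≈?_
      (λ w≈v u≈v → ≈-trans u≈v (≈-sym w≈v))
      ([ (λ s⋈u → MembershipP.∈-++⁺ˡ setoid (complete-Ls u (ent-u , s⋈u))) ,
         (λ t⋈u → MembershipP.∈-++⁺ʳ setoid Ls (complete-Lt u (ent-u , t⋈u))) ]′ s⋈u⊎t⋈u)

    counted-in-W : ∀ {x} → (∀ u → Entangled u → Cross x u → Cross s u ⊎ Cross t u) →
                   XIs G x (count (Cross? x) W)
    counted-in-W crosses = XIs-filter W
      (UniqueD.deduplicate-! (≈-decSetoid (n G)) (Ls ++ Lt))
      (All.deduplicate⁺ _≈?_ (All.++⁺ (All.map proj₁ all-Ls) (All.map proj₁ all-Lt)))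
      (λ u ent-u x⋈u → ∈-W ent-u (crosses u ent-u x⋈u))

    X₁ : XIs G c₁ (count (Cross? c₁) W)
    X₁ = counted-in-W (λ _ _ → corner₁-Cross s⋈t)

    X₃ : XIs G c₃ (count (Cross? c₃) W)
    X₃ = counted-in-W (λ _ _ → corner₃-Cross s⋈t)

    s-strict : Any (λ w → ¬ Cross c₁ w × ¬ Cross c₃ w × (Cross s w ⊎ Cross t w)) W
    s-strict = Any.map
      (λ s≈w → (λ c₁⋈w → c₁⋈w (Nested-resp-≈ c₁ s≈w (≼⇒Nested (corner₁-≼ˡ s t)))) ,
               (λ c₃⋈w → c₃⋈w (Nested-resp-≈ c₃ s≈w
                                 (Nested-swapʳ (≼⇒Nested (corner₁-≼ˡ (swap s) (swap t)))))) ,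
               inj₂ (Cross-resp-≈ t s≈w t⋈s))
      (∈-W ent-s (inj₂ t⋈s))
      where
      t⋈s : Cross t s
      t⋈s = s⋈t ∘ Nested-sym

lemma3p4 : (G : Graph) →
    (∀ (ε₁ ε₂ : SepSet (n G)) → IsEntanglement G ε₁ → IsEntanglement G ε₂ →
      ∀ s₁ s₂ → ε₁ s₁ → ε₂ s₂ → Cross s₁ s₂ →
        C1 ε₁ ε₂ s₁ s₂ ⊎ C2 ε₁ ε₂ s₁ s₂) →
    ∀ s t → Friendly G s → Friendly G t → Nested s t
lemma3p4 G H s t (εs , εs-ent , s∈εs , ks , Xs , s-min) (εt , εt-ent , t∈εt , kt , Xt , t-min)
  with Nested? s t
... | yes s∥t = s∥t
... | no s⋈t
  with opposite-corners-x G (εs , εs-ent , s∈εs) s⋈t Xs Xt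
     | opposite-corners-x G (εs , εs-ent , s∈εs) (Cross-swapʳ s⋈t) Xs (XIs-swap {G} Xt)
... | k₁ , k₃ , X₁ , X₃ , k₁+k₃<ks+kt | k₂ , k₄ , X₂ , X₄ , k₂+k₄<ks+kt =
  ⊥-elim (excluded (H εs εt εs-ent εt-ent s t s∈εs t∈εt s⋈t))
  where
  ks≤ : ∀ {c k} → εs c → XIs G c k → ks ≤ k
  ks≤ c∈εs Xc = ≮⇒≥ (s-min _ _ c∈εs Xc)
  kt≤ : ∀ {c k} → εt c → XIs G c k → kt ≤ k
  kt≤ c∈εt Xc = ≮⇒≥ (t-min _ _ c∈εt Xc)
  below₁₃ : ∀ {a b} → a ≤ k₁ → b ≤ k₃ → a + b < ks + kt
  below₁₃ a≤k₁ b≤k₃ = ≤-<-trans (+-mono-≤ a≤k₁ b≤k₃) k₁+k₃<ks+kt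
  below₂₄ : ∀ {a b} → a ≤ k₂ → b ≤ k₄ → a + b < ks + kt
  below₂₄ a≤k₂ b≤k₄ = ≤-<-trans (+-mono-≤ a≤k₂ b≤k₄) k₂+k₄<ks+kt

  excluded : C1 εs εt s t ⊎ C2 εs εt s t → ⊥
  excluded (inj₁ (inj₁ (c₁∈εs , c₃∈εt))) = <-irrefl refl (below₁₃ (ks≤ c₁∈εs X₁) (kt≤ c₃∈εt X₃))
  excluded (inj₁ (inj₂ (inj₁ (c₃∈εs , c₁∈εt)))) =
    <-irrefl (+-comm kt ks) (below₁₃ (kt≤ c₁∈εt X₁) (ks≤ c₃∈εs X₃))
  excluded (inj₁ (inj₂ (inj₂ (inj₁ (c₂∈εs , c₄∈εt))))) =
    <-irrefl refl (below₂₄ (ks≤ c₂∈εs X₂) (kt≤ c₄∈εt X₄))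
  excluded (inj₁ (inj₂ (inj₂ (inj₂ (c₄∈εs , c₂∈εt))))) =
    <-irrefl (+-comm kt ks) (below₂₄ (kt≤ c₂∈εt X₂) (ks≤ c₄∈εs X₄))
  excluded (inj₂ (inj₁ (c₁∈εs , c₃∈εs , c₂∈εt , c₄∈εt))) =
    <-asym (+-cancelˡ-< ks _ _ (below₁₃ (ks≤ c₁∈εs X₁) (ks≤ c₃∈εs X₃)))
           (+-cancelʳ-< kt _ _ (below₂₄ (kt≤ c₂∈εt X₂) (kt≤ c₄∈εt X₄)))
  excluded (inj₂ (inj₂ (c₂∈εs , c₄∈εs , c₁∈εt , c₃∈εt))) =
    <-asym (+-cancelˡ-< ks _ _ (below₂₄ (ks≤ c₂∈εs X₂) (ks≤ c₄∈εs X₄)))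
           (+-cancelʳ-< kt _ _ (below₁₃ (kt≤ c₁∈εt X₁) (kt≤ c₃∈εt X₃)))
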